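{- Let $G(V,E)$ be an $n$-vertex graph, let $O^\star$ be the vertex set of an arbitrary minimum vertex cover of $G$, and $\overline{O^\star}:=V\setminus O^\star$. Let $G_1$ be the bipartite graph obtained from $G$ by removing all edges with both endpoints in $O^\star$, and for $j=1,\dots,t:=\lceil\log n\rceil$ define $O_j:=\{v\in O^\star:\deg_{G_j}(v)\ge n/2^{j}\}$, $\overline{O}_j:=\{v\in \overline{O^\star}:\deg_{G_j}(v)\ge n/2^{j+2}\}$, and $G_{j+1}:=G_j\setminus(O_j\cup\overline{O}_j)$ (removing these vertices). Then $\bigl|\bigcup_{j=1}^{t}(O_j\cup\overline{O}_j)\bigr|=O(\log n)\cdot\mathrm{VC}(G)$.
   Context: $\mathrm{VC}(G)$ denotes the minimum vertex cover size of $G$; $\log$ is base 2. -}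

module Defs where

open import Data.Nat using (ℕ; zero; suc; _*_; _^_; _≤_; _≤ᵇ_)
open import Data.Bool using (Bool; true; false; _∧_; not; if_then_else_)
open import Data.Fin using (Fin)
open import Data.Fin.Subset using (Subset; _∈_; ∣_∣; ⊤; ⊥; _∪_)
open import Data.Vec using (lookup; tabulate)
open import Data.Sum using (_⊎_)
open import Data.Product using (_×_)
open import Relation.Binary.PropositionalEquality using (_≡_)

record Graph (n : ℕ) : Set where
  field
    adj     : Fin n → Fin n → Bool
    sym     : ∀ u v → adj u v ≡ adj v u
    irrefl  : ∀ v → adj v v ≡ false
open Graph public

IsVertexCover : ∀ {n} → Graph n → Subset n → Set
IsVertexCover G C = ∀ u v → adj G u v ≡ true → (u ∈ C) ⊎ (v ∈ C)

IsMinVertexCover : ∀ {n} → Graph n → Subset n → Set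
IsMinVertexCover G C =
  IsVertexCover G C × (∀ C' → IsVertexCover G C' → ∣ C ∣ ≤ ∣ C' ∣)

adj₁ : ∀ {n} → Graph n → Subset n → Fin n → Fin n → Bool
adj₁ G O u v = adj G u v ∧ not (lookup O u ∧ lookup O v)

-- Degree of v in the subgraph of G₁ induced on the remaining vertex set R
deg : ∀ {n} → Graph n → Subset n → Subset n → Fin n → ℕ
deg G O R v = ∣ tabulate (λ u → lookup R u ∧ adj₁ G O v u) ∣

-- The vertices removed in round j when the current graph is G₁[R] (= G_j):
-- O_j ∪ Ō_j, where v ∈ O_j iff v ∈ R ∩ O⋆ and deg ≥ n/2^j  (i.e. n ≤ deg·2^j),
-- and v ∈ Ō_j iff v ∈ R ∖ O⋆ and deg ≥ n/2^(j+2) (i.e. n ≤ deg·2^(j+2)).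
removed : ∀ {n} → Graph n → Subset n → ℕ → Subset n → Subset n
removed {n} G O j R = tabulate λ v →
  lookup R v ∧
  (if lookup O v
     then n ≤ᵇ deg G O R v * 2 ^ j
     else n ≤ᵇ deg G O R v * 2 ^ (j + 2))
  where open Data.Nat using (_+_)

-- Remaining vertex set after rounds 1..k (vertex set of G_{k+1});
-- G_1 has all vertices.
remaining : ∀ {n} → Graph n → Subset n → ℕ → Subset n
remaining G O zero    = ⊤
remaining G O (suc k) =
  let R = remaining G O k in
  tabulate λ v → lookup R v ∧ not (lookup (removed G O (suc k) R) v)

removedUpTo : ∀ {n} → Graph n → Subset n → ℕ → Subset n
removedUpTo G O zero    = ⊥
removedUpTo G O (suc k) =
  removedUpTo G O k ∪ removed G O (suc k) (remaining G O k)

-- Every round removes at most 9·|O⋆| vertices. The removed cover vertices O_j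
-- number at most |O⋆|. For Ō_j: every cover vertex of G_j has degree ≤ n/2^(j−1),
-- since it survived round j − 1 and degrees only drop; and every edge
-- of G_j joins a vertex outside O⋆ to one in O⋆, because O⋆ is a cover and G₁
-- has no edges inside O⋆. Double counting these edges,
--   |Ō_j| · n/2^(j+2) ≤ Σ_{v ∉ O⋆} deg v ≤ Σ_{u ∈ O⋆} deg u ≤ |O⋆| · n/2^(j−1),
-- so |Ō_j| ≤ 8·|O⋆|.
module Submission where

open import Defs hiding (sym)
open import Data.Nat using (ℕ; zero; suc; _+_; _*_; _^_; _≤_; _≤ᵇ_; z≤n; s≤s)
open import Data.Nat.Properties
open import Data.Nat.Logarithm using (⌈log₂_⌉)
open import Data.Nat.Solver using (module +-*-Solver)
open import Data.Bool using (Bool; true; false; _∧_; _∨_; not; if_then_else_; T)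
open import Data.Bool.Properties using (∧-comm; T-∧; T-≡; T-not-≡)
open import Data.Empty using (⊥-elim)
open import Data.Unit using (tt)
open import Data.Fin using (Fin; zero; suc)
open import Data.Fin.Subset using (Subset; ∣_∣; _∪_)
open import Data.Fin.Subset.Properties using (∣p∣≤n; ∣⊥∣≡0)
open import Data.Vec using ([]; _∷_; lookup; tabulate)
open import Data.Vec.Properties using (lookup∘tabulate; lookup-zipWith; []=⇒lookup)
open import Data.Product using (∃; _×_; _,_; proj₁; proj₂)
open import Data.Sum using (inj₁; inj₂)
open import Function using (_∘_)
open import Function.Bundles using (Equivalence)
open import Relation.Nullary using (¬_)
open import Relation.Binary.PropositionalEquality
  using (_≡_; refl; sym; trans; cong; cong₂; subst)
open import Algebra.Properties.Semiring.Sum +-*-semiring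
  using (sum; sum-syntax; sum-cong-≗; ∑-comm; ∑-distrib-+; *-distribˡ-sum; *-distribʳ-sum)

open +-*-Solver using (solve; _:*_; _:=_; con)
open Equivalence using (to; from)

𝟙 : Bool → ℕ
𝟙 true  = 1
𝟙 false = 0

𝟙-mono : ∀ {a b} → (T a → T b) → 𝟙 a ≤ 𝟙 b
𝟙-mono {false}         _   = z≤n
𝟙-mono {true} {true}   _   = ≤-refl
𝟙-mono {true} {false} a⇒b = ⊥-elim (a⇒b tt)

𝟙-∨ : ∀ a b → 𝟙 (a ∨ b) ≤ 𝟙 a + 𝟙 b
𝟙-∨ true  b = s≤s z≤n
𝟙-∨ false b = ≤-refl

𝟙-∧ : ∀ a b → 𝟙 (a ∧ b) ≡ 𝟙 a * 𝟙 b
𝟙-∧ true  b = sym (+-identityʳ (𝟙 b))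
𝟙-∧ false b = refl

𝟙-*-mono : ∀ b {x y} → (T b → x ≤ y) → 𝟙 b * x ≤ 𝟙 b * y
𝟙-*-mono true  x≤y = *-monoʳ-≤ 1 (x≤y tt)
𝟙-*-mono false _   = z≤n

sum-mono-≤ : ∀ {n} {f g : Fin n → ℕ} → (∀ i → f i ≤ g i) → sum f ≤ sum g
sum-mono-≤ {zero}  f≤g = z≤n
sum-mono-≤ {suc n} f≤g = +-mono-≤ (f≤g zero) (sum-mono-≤ (f≤g ∘ suc))

#_ : ∀ {n} → (Fin n → Bool) → ℕ
#_ {n} P = ∑[ i < n ] 𝟙 (P i)

∑∈-syntax : ∀ {n} → (Fin n → Bool) → (Fin n → ℕ) → ℕ
∑∈-syntax {n} P f = ∑[ i < n ] (𝟙 (P i) * f i)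

-- Unlike ∑[ i < n ], the body of ∑[ i ∈ P ] extends over _+_ and _*_.
infix 5 ∑∈-syntax
syntax ∑∈-syntax P (λ i → x) = ∑[ i ∈ P ] x

#-mono : ∀ {n} (P Q : Fin n → Bool) → (∀ i → T (P i) → T (Q i)) → # P ≤ # Q
#-mono P Q P⇒Q = sum-mono-≤ (λ i → 𝟙-mono (P⇒Q i))

#-≤-+ : ∀ {n} {P Q R : Fin n → Bool} → (∀ i → T (P i) → T (Q i ∨ R i)) → # P ≤ # Q + # R
#-≤-+ {n} {P} {Q} {R} P⇒Q∨R = begin
  # P                               ≤⟨ #-mono P (λ i → Q i ∨ R i) P⇒Q∨R ⟩
  # (λ i → Q i ∨ R i)               ≤⟨ sum-mono-≤ (λ i → 𝟙-∨ (Q i) (R i)) ⟩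
  ∑[ i < n ] (𝟙 (Q i) + 𝟙 (R i))  ≡⟨ ∑-distrib-+ (𝟙 ∘ Q) (𝟙 ∘ R) ⟩
  # Q + # R                         ∎
  where open ≤-Reasoning

#-cancelˡ-≤ : ∀ {n} (P : Fin n → Bool) c → n * # P ≤ n * c → # P ≤ c
#-cancelˡ-≤ {zero}  P c _        = z≤n
#-cancelˡ-≤ {suc n} P c n#P≤n*c = *-cancelˡ-≤ (suc n) n#P≤n*c

∣p∣≡#lookup : ∀ {n} (p : Subset n) → ∣ p ∣ ≡ # (lookup p)
∣p∣≡#lookup []          = refl
∣p∣≡#lookup (true ∷ p)  = cong suc (∣p∣≡#lookup p)
∣p∣≡#lookup (false ∷ p) = ∣p∣≡#lookup p

∣tabulate∣≡# : ∀ {n} (P : Fin n → Bool) → ∣ tabulate P ∣ ≡ # P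
∣tabulate∣≡# P = trans (∣p∣≡#lookup (tabulate P)) (sum-cong-≗ (cong 𝟙 ∘ lookup∘tabulate P))

∣p∪q∣≤∣p∣+∣q∣ : ∀ {n} (p q : Subset n) → ∣ p ∪ q ∣ ≤ ∣ p ∣ + ∣ q ∣
∣p∪q∣≤∣p∣+∣q∣ p q = begin
  ∣ p ∪ q ∣               ≡⟨ ∣p∣≡#lookup (p ∪ q) ⟩
  # lookup (p ∪ q)        ≤⟨ #-≤-+ (λ i → subst T (lookup-zipWith _∨_ i p q)) ⟩
  # lookup p + # lookup q ≡⟨ sym (cong₂ _+_ (∣p∣≡#lookup p) (∣p∣≡#lookup q)) ⟩
  ∣ p ∣ + ∣ q ∣           ∎
  where open ≤-Reasoning

∑∈-cong : ∀ {n} (P : Fin n → Bool) {f g : Fin n → ℕ} →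
          (∀ i → f i ≡ g i) → ∑[ i ∈ P ] f i ≡ ∑[ i ∈ P ] g i
∑∈-cong P f≡g = sum-cong-≗ (λ i → cong (𝟙 (P i) *_) (f≡g i))

∑∈-mono : ∀ {n} (P Q : Fin n → Bool) (f : Fin n → ℕ) →
          (∀ i → T (P i) → T (Q i)) → ∑[ i ∈ P ] f i ≤ ∑[ i ∈ Q ] f i
∑∈-mono P Q f P⇒Q = sum-mono-≤ (λ i → *-monoˡ-≤ (f i) (𝟙-mono (P⇒Q i)))

∑∈-*ʳ : ∀ {n} (P : Fin n → Bool) (f : Fin n → ℕ) c →
        ∑[ i ∈ P ] f i * c ≡ (∑[ i ∈ P ] f i) * c
∑∈-*ʳ P f c = trans (sum-cong-≗ (λ i → sym (*-assoc (𝟙 (P i)) (f i) c)))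
                    (sym (*-distribʳ-sum c (λ i → 𝟙 (P i) * f i)))

*-#≤∑∈ : ∀ {n} (P : Fin n → Bool) {f : Fin n → ℕ} c →
         (∀ i → T (P i) → c ≤ f i) → c * # P ≤ ∑[ i ∈ P ] f i
*-#≤∑∈ {n} P {f} c c≤f = begin
  c * # P                   ≡⟨ *-distribˡ-sum c (𝟙 ∘ P) ⟩
  ∑[ i < n ] (c * 𝟙 (P i))  ≤⟨ sum-mono-≤ (λ i → ≤-trans (≤-reflexive (*-comm c (𝟙 (P i))))
                                                         (𝟙-*-mono (P i) (c≤f i))) ⟩
  ∑[ i ∈ P ] f i            ∎
  where open ≤-Reasoning

∑∈≤#* : ∀ {n} (P : Fin n → Bool) {f : Fin n → ℕ} c →
        (∀ i → T (P i) → f i ≤ c) → ∑[ i ∈ P ] f i ≤ # P * c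
∑∈≤#* P c f≤c = ≤-trans (sum-mono-≤ (λ i → 𝟙-*-mono (P i) (f≤c i)))
                        (≤-reflexive (sym (*-distribʳ-sum c (𝟙 ∘ P))))

∑∈#≡∑# : ∀ {m n} (P : Fin m → Bool) (E : Fin m → Fin n → Bool) →
         ∑[ i ∈ P ] # (E i) ≡ ∑[ i < m ] # (λ j → P i ∧ E i j)
∑∈#≡∑# P E = sum-cong-≗ λ i → trans (*-distribˡ-sum (𝟙 (P i)) (𝟙 ∘ E i))
                                     (sum-cong-≗ (λ j → sym (𝟙-∧ (P i) (E i j))))

∑∈#-double-count : ∀ {m n} (P : Fin m → Bool) (Q : Fin n → Bool)
                   (E : Fin m → Fin n → Bool) (F : Fin n → Fin m → Bool) →
                   (∀ i j → T (P i ∧ E i j) → T (Q j ∧ F j i)) →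
                   ∑[ i ∈ P ] # (E i) ≤ ∑[ j ∈ Q ] # (F j)
∑∈#-double-count {m} {n} P Q E F edge = begin
  ∑[ i ∈ P ] # (E i)                     ≡⟨ ∑∈#≡∑# P E ⟩
  ∑[ i < m ] ∑[ j < n ] 𝟙 (P i ∧ E i j)  ≤⟨ sum-mono-≤ (λ i → #-mono _ _ (edge i)) ⟩
  ∑[ i < m ] ∑[ j < n ] 𝟙 (Q j ∧ F j i)  ≡⟨ ∑-comm (λ i j → 𝟙 (Q j ∧ F j i)) ⟩
  ∑[ j < n ] ∑[ i < m ] 𝟙 (Q j ∧ F j i)  ≡⟨ sym (∑∈#≡∑# Q F) ⟩
  ∑[ j ∈ Q ] # (F j)                     ∎
  where open ≤-Reasoning

∧-if⇒∨ : ∀ r o a b → T (r ∧ (if o then a else b)) → T (o ∨ (r ∧ not o) ∧ b)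
∧-if⇒∨ true true  a b _ = tt
∧-if⇒∨ true false a b t = t

d*2ᵏ≤m⇒d*2ᵏ⁺³≤8*m : ∀ d k m → d * 2 ^ k ≤ m → d * 2 ^ (suc k + 2) ≤ 8 * m
d*2ᵏ≤m⇒d*2ᵏ⁺³≤8*m d k m d2ᵏ≤m rewrite +-comm k 2 = begin
  d * (2 * (2 * (2 * 2 ^ k)))
    ≡⟨ solve 2 (λ d p → d :* (con 2 :* (con 2 :* (con 2 :* p))) := con 8 :* (d :* p)) refl d (2 ^ k) ⟩
  8 * (d * 2 ^ k)  ≤⟨ *-monoʳ-≤ 8 d2ᵏ≤m ⟩
  8 * m            ∎
  where open ≤-Reasoning

module _ {n : ℕ} (G : Graph n) (O : Subset n) where

  _∩O _∖O : Subset n → Fin n → Bool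
  (R ∩O) v = lookup R v ∧ lookup O v
  (R ∖O) v = lookup R v ∧ not (lookup O v)

  adjIn : Subset n → Fin n → Fin n → Bool
  adjIn R v u = lookup R u ∧ adj₁ G O v u

  adj₁-sym : ∀ u v → adj₁ G O u v ≡ adj₁ G O v u
  adj₁-sym u v = cong₂ _∧_ (Graph.sym G u v) (cong not (∧-comm (lookup O u) (lookup O v)))

  deg≡# : ∀ R v → deg G O R v ≡ # (adjIn R v)
  deg≡# R v = ∣tabulate∣≡# (adjIn R v)

  deg≤n : ∀ R v → deg G O R v ≤ n
  deg≤n R v = ∣p∣≤n (tabulate (adjIn R v))

  deg-mono : ∀ R R′ v → (∀ u → T (lookup R u) → T (lookup R′ u)) → deg G O R v ≤ deg G O R′ v
  deg-mono R R′ v R⊆R′ = begin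
    deg G O R v    ≡⟨ deg≡# R v ⟩
    # adjIn R v    ≤⟨ #-mono (adjIn R v) (adjIn R′ v) adjIn-mono ⟩
    # adjIn R′ v   ≡⟨ sym (deg≡# R′ v) ⟩
    deg G O R′ v   ∎
    where
    open ≤-Reasoning
    adjIn-mono : ∀ u → T (adjIn R v u) → T (adjIn R′ v u)
    adjIn-mono u t = let u∈R , a = to T-∧ t in from T-∧ (R⊆R′ u u∈R , a)

  Ō : ℕ → Subset n → Fin n → Bool
  Ō j R v = (R ∖O) v ∧ (n ≤ᵇ deg G O R v * 2 ^ (j + 2))

  LowCoverDegree : ℕ → Subset n → Set
  LowCoverDegree k R = ∀ u → T (lookup R u) → T (lookup O u) → deg G O R u * 2 ^ k ≤ n

  lookup-removed : ∀ j R v → lookup (removed G O j R) v ≡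
    lookup R v ∧ (if lookup O v then n ≤ᵇ deg G O R v * 2 ^ j
                                 else n ≤ᵇ deg G O R v * 2 ^ (j + 2))
  lookup-removed j R v = lookup∘tabulate _ v

  removed-cover : ∀ j R u → T (lookup R u) → T (lookup O u) →
                  n ≤ deg G O R u * 2 ^ j → T (lookup (removed G O j R) u)
  removed-cover j R u u∈R u∈O n≤d2ʲ
    rewrite lookup-removed j R u | to T-≡ u∈R | to T-≡ u∈O = ≤⇒≤ᵇ n≤d2ʲ

  ∣removed∣≤∣O∣+#Ō : ∀ j R → ∣ removed G O j R ∣ ≤ ∣ O ∣ + # Ō j R
  ∣removed∣≤∣O∣+#Ō j R = begin
    ∣ removed G O j R ∣         ≡⟨ ∣p∣≡#lookup (removed G O j R) ⟩
    # lookup (removed G O j R)  ≤⟨ #-≤-+ removed⇒O∨Ō ⟩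
    # lookup O + # Ō j R        ≡⟨ cong (_+ # Ō j R) (sym (∣p∣≡#lookup O)) ⟩
    ∣ O ∣ + # Ō j R             ∎
    where
    open ≤-Reasoning
    removed⇒O∨Ō : ∀ v → T (lookup (removed G O j R) v) → T (lookup O v ∨ Ō j R v)
    removed⇒O∨Ō v = ∧-if⇒∨ (lookup R v) (lookup O v) _ _ ∘ subst T (lookup-removed j R v)

  remaining-suc⁻ : ∀ k u → T (lookup (remaining G O (suc k)) u) →
                   T (lookup (remaining G O k) u) ×
                   ¬ T (lookup (removed G O (suc k) (remaining G O k)) u)
  remaining-suc⁻ k u t =
    let u∈R , u∉removed = to T-∧ (subst T (lookup∘tabulate _ u) t)
    in u∈R , subst T (to T-not-≡ u∉removed)

  remaining-lowCoverDegree : ∀ k → LowCoverDegree k (remaining G O k)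
  remaining-lowCoverDegree zero    u _ _ =
    ≤-trans (≤-reflexive (*-identityʳ _)) (deg≤n (remaining G O 0) u)
  remaining-lowCoverDegree (suc k) u u∈R′ u∈O with remaining-suc⁻ k u u∈R′
  ... | u∈R , u∉removed = begin
    deg G O R′ u * 2 ^ suc k
      ≤⟨ *-monoˡ-≤ (2 ^ suc k) (deg-mono R′ R u (λ w → proj₁ ∘ remaining-suc⁻ k w)) ⟩
    deg G O R u * 2 ^ suc k
      ≤⟨ <⇒≤ (≰⇒> (u∉removed ∘ removed-cover (suc k) R u u∈R u∈O)) ⟩
    n ∎
    where
    open ≤-Reasoning
    R  = remaining G O k
    R′ = remaining G O (suc k)

  module _ (cover : IsVertexCover G O) where

    cover-neighbour : ∀ v u → T (adj₁ G O v u) → T (not (lookup O v)) → T (lookup O u)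
    cover-neighbour v u a v∉O with cover v u (to T-≡ (proj₁ (to T-∧ a)))
    ... | inj₁ v∈O = ⊥-elim (subst T (to T-not-≡ v∉O) (from T-≡ ([]=⇒lookup v∈O)))
    ... | inj₂ u∈O = from T-≡ ([]=⇒lookup u∈O)

    ∑deg-∖O≤∑deg-∩O : ∀ R → ∑[ v ∈ R ∖O ] deg G O R v ≤ ∑[ u ∈ R ∩O ] deg G O R u
    ∑deg-∖O≤∑deg-∩O R = begin
      ∑[ v ∈ R ∖O ] deg G O R v  ≡⟨ ∑∈-cong (R ∖O) (deg≡# R) ⟩
      ∑[ v ∈ R ∖O ] # adjIn R v  ≤⟨ ∑∈#-double-count (R ∖O) (R ∩O) (adjIn R) (adjIn R) edge ⟩
      ∑[ u ∈ R ∩O ] # adjIn R u  ≡⟨ sym (∑∈-cong (R ∩O) (deg≡# R)) ⟩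
      ∑[ u ∈ R ∩O ] deg G O R u  ∎
      where
      open ≤-Reasoning
      edge : ∀ v u → T ((R ∖O) v ∧ adjIn R v u) → T ((R ∩O) u ∧ adjIn R u v)
      edge v u t with to (T-∧ {(R ∖O) v}) t
      ... | v∈R∖O , u∈R∧a with to (T-∧ {lookup R v}) v∈R∖O | to (T-∧ {lookup R u}) u∈R∧a
      ... | v∈R , v∉O | u∈R , a =
        from T-∧ ( from T-∧ (u∈R , cover-neighbour v u a v∉O)
                 , from T-∧ (v∈R , subst T (adj₁-sym v u) a))

    #Ō≤8∣O∣ : ∀ k R → LowCoverDegree k R → # Ō (suc k) R ≤ 8 * ∣ O ∣
    #Ō≤8∣O∣ k R low = #-cancelˡ-≤ (Ō (suc k) R) (8 * ∣ O ∣) (begin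
      n * # Ō (suc k) R
        ≤⟨ *-#≤∑∈ (Ō (suc k) R) n (λ v → ≤ᵇ⇒≤ n _ ∘ proj₂ ∘ to T-∧) ⟩
      ∑[ v ∈ Ō (suc k) R ] d v * 2ᵏ⁺³
        ≤⟨ ∑∈-mono (Ō (suc k) R) (R ∖O) (λ v → d v * 2ᵏ⁺³) (λ v → proj₁ ∘ to T-∧) ⟩
      ∑[ v ∈ R ∖O ] d v * 2ᵏ⁺³
        ≡⟨ ∑∈-*ʳ (R ∖O) d 2ᵏ⁺³ ⟩
      (∑[ v ∈ R ∖O ] d v) * 2ᵏ⁺³
        ≤⟨ *-monoˡ-≤ 2ᵏ⁺³ (∑deg-∖O≤∑deg-∩O R) ⟩
      (∑[ u ∈ R ∩O ] d u) * 2ᵏ⁺³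
        ≡⟨ sym (∑∈-*ʳ (R ∩O) d 2ᵏ⁺³) ⟩
      ∑[ u ∈ R ∩O ] d u * 2ᵏ⁺³
        ≤⟨ ∑∈≤#* (R ∩O) (8 * n) cover-weight ⟩
      # (R ∩O) * (8 * n)
        ≤⟨ *-monoˡ-≤ (8 * n) (#-mono (R ∩O) (lookup O) (λ u → proj₂ ∘ to T-∧)) ⟩
      # lookup O * (8 * n)
        ≡⟨ cong (_* (8 * n)) (sym (∣p∣≡#lookup O)) ⟩
      ∣ O ∣ * (8 * n)
        ≡⟨ solve 2 (λ o m → o :* (con 8 :* m) := m :* (con 8 :* o)) refl ∣ O ∣ n ⟩
      n * (8 * ∣ O ∣)
        ∎)
      where
      open ≤-Reasoning
      d : Fin n → ℕ
      d = deg G O R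
      2ᵏ⁺³ : ℕ
      2ᵏ⁺³ = 2 ^ (suc k + 2)
      cover-weight : ∀ u → T ((R ∩O) u) → d u * 2ᵏ⁺³ ≤ 8 * n
      cover-weight u t =
        let u∈R , u∈O = to T-∧ t in d*2ᵏ≤m⇒d*2ᵏ⁺³≤8*m (d u) k n (low u u∈R u∈O)

    ∣removed∣≤9∣O∣ : ∀ k R → LowCoverDegree k R → ∣ removed G O (suc k) R ∣ ≤ 9 * ∣ O ∣
    ∣removed∣≤9∣O∣ k R low =
      ≤-trans (∣removed∣≤∣O∣+#Ō (suc k) R) (+-monoʳ-≤ ∣ O ∣ (#Ō≤8∣O∣ k R low))

    ∣removedUpTo∣≤k*9∣O∣ : ∀ k → ∣ removedUpTo G O k ∣ ≤ k * (9 * ∣ O ∣)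
    ∣removedUpTo∣≤k*9∣O∣ zero    = ≤-reflexive (∣⊥∣≡0 n)
    ∣removedUpTo∣≤k*9∣O∣ (suc k) = begin
      ∣ removedUpTo G O k ∪ removed G O (suc k) R ∣
        ≤⟨ ∣p∪q∣≤∣p∣+∣q∣ (removedUpTo G O k) (removed G O (suc k) R) ⟩
      ∣ removedUpTo G O k ∣ + ∣ removed G O (suc k) R ∣
        ≤⟨ +-mono-≤ (∣removedUpTo∣≤k*9∣O∣ k) (∣removed∣≤9∣O∣ k R (remaining-lowCoverDegree k)) ⟩
      k * (9 * ∣ O ∣) + 9 * ∣ O ∣
        ≡⟨ +-comm (k * (9 * ∣ O ∣)) (9 * ∣ O ∣) ⟩
      suc k * (9 * ∣ O ∣) ∎
      where
      open ≤-Reasoning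
      R = remaining G O k

lemma3 : ∃ λ (c : ℕ) → ∀ (n : ℕ) (G : Graph n) (O : Subset n)
           → IsMinVertexCover G O
           → ∣ removedUpTo G O ⌈log₂ n ⌉ ∣ ≤ c * ⌈log₂ n ⌉ * ∣ O ∣
lemma3 = 9 , λ n G O (cover , _) → begin
  ∣ removedUpTo G O ⌈log₂ n ⌉ ∣
    ≤⟨ ∣removedUpTo∣≤k*9∣O∣ G O cover ⌈log₂ n ⌉ ⟩
  ⌈log₂ n ⌉ * (9 * ∣ O ∣)
    ≡⟨ solve 2 (λ t o → t :* (con 9 :* o) := con 9 :* t :* o) refl ⌈log₂ n ⌉ ∣ O ∣ ⟩
  9 * ⌈log₂ n ⌉ * ∣ O ∣
    ∎
  where open ≤-Reasoning
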